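{- Pseudo-flipping is well-defined. That is, given any two flippable (in the classical sense) pairs of $d$-minimal triangles $(S_1, S_2)$ and $(S_1', S_2')$ satisfying $W(S_1) = W(S_1') = \omega_1$ and $W(S_2) = W(S_2') = \omega_2$, exchanging the diagonals of the parallelograms $\mathcal{P}$ and $\mathcal{P'}$ from the common edge shared by $(S_1, S_2)$ and $(S_1', S_2')$, respectively, results in minimal triangles $(S_3, S_4)$ and $(S_3', S_4')$, respectively, satisfying $W(S_3) = W(S_3') = \omega_3$ and $W(S_4) = W(S_4') = \omega_4$.
   Context: Let $\mathcal{L}_d = \frac{1}{d}\mathbb{Z}\times\frac{1}{d}\mathbb{Z}$; a triangle is $d$-minimal if it meets $\mathcal{L}_d$ only in its vertices. For an oriented $d$-minimal edge from $p=(w/d,x/d)$ to $q=(y/d,z/d)$ its weight is $\det\begin{pmatrix} w & y\\ x & z\end{pmatrix} \bmod d$, and the weight $W(S)$ of a $d$-minimal triangle is the multiset of weights of its edges oriented counterclockwise; two $d$-minimal triangles are equivalent under $G = GL_2(\mathbb{Z})\rtimes\mathbb{Z}^2$ (acting by $x\mapsto Ux+v$) iff their weights agree. A pair of adjacent $d$-minimal triangles is flippable (classically) if they form a convex quadrilateral, which for $d$-minimal triangles is a parallelogram; the flip exchanges the shared diagonal for the other diagonal. -}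

module Defs where

open import Data.Nat using (ℕ; NonZero)
open import Data.Integer using (ℤ; +_; _+_; _-_; _*_; _≤?_; 0ℤ)
open import Data.Integer.DivMod using (_%ℕ_)
open import Data.Product using (_×_; _,_; ∃-syntax)
open import Data.Sum using (_⊎_)
open import Data.Bool using (if_then_else_)
open import Data.List using (List; _∷_; [])
open import Relation.Nullary using (¬_)
open import Relation.Nullary.Decidable using (⌊_⌋)
open import Relation.Binary.PropositionalEquality using (_≡_)

-- A point (w/d , x/d) of the lattice L_d is represented by its integer
-- coordinates (w , x) ∈ ℤ²; thus L_d corresponds exactly to ℤ × ℤ.
Pt : Set
Pt = ℤ × ℤ

det : Pt → Pt → ℤ
det (w , x) (y , z) = w * z - x * y

_⊖_ : Pt → Pt → Pt
(a₁ , a₂) ⊖ (b₁ , b₂) = (a₁ - b₁ , a₂ - b₂)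

orient : Pt → Pt → Pt → ℤ
orient a b c = det (b ⊖ a) (c ⊖ a)

_·_ : ℕ → Pt → Pt
n · (x , y) = (+ n * x , + n * y)

_⊕_ : Pt → Pt → Pt
(a₁ , a₂) ⊕ (b₁ , b₂) = (a₁ + b₁ , a₂ + b₂)

-- p lies in the closed convex hull of a, b, c: p is a convex combination
-- with nonnegative rational coefficients l/N, m/N, n/N (N = l+m+n > 0).
InHull : Pt → Pt → Pt → Pt → Set
InHull a b c p = ∃[ l ] ∃[ m ] ∃[ n ]
  (¬ (l Data.Nat.+ m Data.Nat.+ n ≡ 0) ×
   ((l Data.Nat.+ m Data.Nat.+ n) · p ≡ ((l · a) ⊕ (m · b)) ⊕ (n · c)))

-- The (nondegenerate) triangle with vertices a b c is d-minimal: it meets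
-- the lattice L_d (here ℤ²) only in its vertices.
Minimal : Pt → Pt → Pt → Set
Minimal a b c = ¬ (orient a b c ≡ 0ℤ) ×
  (∀ p → InHull a b c p → p ≡ a ⊎ (p ≡ b ⊎ p ≡ c))

edgeW : (d : ℕ) → .{{NonZero d}} → Pt → Pt → ℕ
edgeW d p q = det p q %ℕ d

-- weight of the triangle: multiset (as a list, compared up to permutation)
-- of the weights of its edges oriented counterclockwise
W : (d : ℕ) → .{{NonZero d}} → Pt → Pt → Pt → List ℕ
W d a b c =
  if ⌊ 0ℤ ≤? orient a b c ⌋
  then edgeW d a b ∷ edgeW d b c ∷ edgeW d c a ∷ []
  else edgeW d a c ∷ edgeW d c b ∷ edgeW d b a ∷ []

-- The pair S₁ = (p,q,r), S₂ = (p,q,s) of d-minimal triangles sharing the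
-- edge pq is flippable: their union is a convex quadrilateral, i.e. r and s
-- lie strictly on opposite sides of the line pq and p and q lie strictly on
-- opposite sides of the line rs (the diagonals cross in their interiors).
Flippable : Pt → Pt → Pt → Pt → Set
Flippable p q r s =
  Minimal p q r × Minimal p q s ×
  (orient p q r * orient p q s Data.Integer.< 0ℤ) ×
  (orient r s p * orient r s q Data.Integer.< 0ℤ)

-- A lattice triangle is d-minimal iff it is unimodular,
-- orient a b c = ±1: by Cramer's rule the barycentric coordinates of a lattice
-- point of a unimodular triangle are 0 or 1, while a triangle of orientation
-- D ≥ 2 contains the lattice point (i u + j v)/D obtained from a row of the
-- adjugate matrix of (u v) = (b - a, c - a) (minimal⇒unimodular).
--
-- For a flippable pair p q r, p q s the four
-- orientations are forced up to exchanging p and q, and s = p + q - r.  So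
-- the new triangles r s p, r s q are unimodular, hence minimal, and with
-- a = det p q, b = det q r, c = det r p (so a + b + c = 1) the weights of
-- p q r, p q s, r s p, r s q are the residues of {a, b, c}, {a+c, a+b, -a},
-- {c, a+c, b-c} and {c-b, a+b, b} (flippable-profile).
--
-- As a + c = 1 - b and a + b = 1 - c, the second weight arises
-- from {1-a, 1-b, 1-c} by exchanging 1-a for -a; counting multiplicities, the
-- first two weights therefore determine a modulo d, then {b, c} up to order,
-- and so the last two weights up to exchanging them (flip-weights).

module Submission where

open import Defs
open import Data.Nat as ℕ using (ℕ; NonZero; zero; suc)
import Data.Nat.Properties as ℕP
import Data.Nat.Tactic.RingSolver as ℕSolver
open import Data.Nat.ListAction using (sum)
open import Data.Nat.ListAction.Properties using (sum-↭)
open import Data.Integer using (ℤ; +_; -[1+_]; +[1+_]; _+_; _-_; _*_; -_; 0ℤ; 1ℤ; -1ℤ; _<_; +<+)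
import Data.Integer as ℤ
open import Data.Integer.Properties
  using (+-injective; pos-+; pos-*; abs-*; *-cancelˡ-≡; *-zeroʳ; *-identityʳ; *-identityˡ; *-comm; i-j≡0⇒i≡j)
open import Data.Integer.DivMod using (_%ℕ_; _/ℕ_; a≡a%ℕn+[a/ℕn]*n; n%ℕd<d)
open import Data.Integer.Tactic.RingSolver using (solve-∀)
open import Data.Empty using (⊥-elim)
open import Data.Product using (_×_; _,_; proj₁; proj₂; ∃-syntax)
open import Data.Sum using (_⊎_; inj₁; inj₂; [_,_]′)
open import Data.List using (List; []; _∷_; map)
open import Data.List.Relation.Binary.Permutation.Propositional
  using (_↭_; module PermutationReasoning; ↭-refl; ↭-sym; ↭-trans; ↭-reflexive; prep; swap)
open import Data.List.Relation.Binary.Permutation.Propositional.Properties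
  using (map⁺; drop-∷; shift; ↭-singleton-inv; ∈-resp-↭)
open import Data.List.Relation.Unary.Any using (here; there)
open import Relation.Nullary using (¬_; yes; no)
open import Relation.Binary.Definitions using (DecidableEquality)
open import Relation.Binary.PropositionalEquality
  using (_≡_; refl; sym; trans; subst; subst₂; cong; cong₂; module ≡-Reasoning)

module _ {A : Set} where

  SamePair : List A → List A → List A → List A → Set
  SamePair X Y X′ Y′ = (X ↭ X′ × Y ↭ Y′) ⊎ (X ↭ Y′ × Y ↭ X′)

  SamePair-sym : ∀ {X Y X′ Y′} → SamePair X Y X′ Y′ → SamePair X′ Y′ X Y
  SamePair-sym (inj₁ (P , Q)) = inj₁ (↭-sym P , ↭-sym Q)
  SamePair-sym (inj₂ (P , Q)) = inj₂ (↭-sym Q , ↭-sym P)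

  SamePair-trans : ∀ {X Y X′ Y′ X″ Y″} → SamePair X Y X′ Y′ → SamePair X′ Y′ X″ Y″ →
                   SamePair X Y X″ Y″
  SamePair-trans (inj₁ (P , Q)) (inj₁ (P′ , Q′)) = inj₁ (↭-trans P P′ , ↭-trans Q Q′)
  SamePair-trans (inj₁ (P , Q)) (inj₂ (P′ , Q′)) = inj₂ (↭-trans P P′ , ↭-trans Q Q′)
  SamePair-trans (inj₂ (P , Q)) (inj₁ (P′ , Q′)) = inj₂ (↭-trans P Q′ , ↭-trans Q P′)
  SamePair-trans (inj₂ (P , Q)) (inj₂ (P′ , Q′)) = inj₁ (↭-trans P Q′ , ↭-trans Q P′)

  rotate-↭ : ∀ (x y z : A) → x ∷ y ∷ z ∷ [] ↭ y ∷ z ∷ x ∷ []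
  rotate-↭ x y z = ↭-trans (swap x y ↭-refl) (prep y (swap x z ↭-refl))

module Multiplicity {A : Set} (_≟_ : DecidableEquality A) where

  δ : A → A → ℕ
  δ v w with v ≟ w
  ... | yes _ = 1
  ... | no  _ = 0

  δ-self : ∀ v → δ v v ≡ 1
  δ-self v with v ≟ v
  ... | yes _   = refl
  ... | no  v≢v = ⊥-elim (v≢v refl)

  δ-distinct : ∀ {v w} → ¬ v ≡ w → δ v w ≡ 0
  δ-distinct {v} {w} v≢w with v ≟ w
  ... | yes v≡w = ⊥-elim (v≢w v≡w)
  ... | no  _   = refl

  mult : A → List A → ℕ
  mult v xs = sum (map (δ v) xs)

  mult-↭ : ∀ v {xs ys} → xs ↭ ys → mult v xs ≡ mult v ys
  mult-↭ v p = sum-↭ (map⁺ (δ v) p)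

  -- Exchanging one element of a multiset M for another is determined by the
  -- element removed: if M + x = L + y with x ≠ y, and M + x′ = L + y′, then y = y′
  -- (count the occurrences of y on both sides).
  exchange-unique : ∀ {x y x′ y′ M L} → ¬ x ≡ y →
                    x ∷ M ↭ y ∷ L → x′ ∷ M ↭ y′ ∷ L → y ≡ y′
  exchange-unique {x} {y} {x′} {y′} {M} {L} x≢y P P′ with y ≟ y′
  ... | yes y≡y′ = y≡y′
  ... | no  y≢y′ = ⊥-elim (ℕP.<-irrefl refl (subst (mult y L ℕ.<_) count′ (ℕP.m≤n+m (suc (mult y L)) (δ y x′))))
    where
    open ≡-Reasoning
    count : mult y M ≡ suc (mult y L)
    count = begin
      mult y M                   ≡⟨ cong (ℕ._+ mult y M) (sym (δ-distinct (λ y≡x → x≢y (sym y≡x)))) ⟩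
      δ y x ℕ.+ mult y M         ≡⟨ mult-↭ y P ⟩
      δ y y ℕ.+ mult y L         ≡⟨ cong (ℕ._+ mult y L) (δ-self y) ⟩
      suc (mult y L)             ∎
    count′ : δ y x′ ℕ.+ suc (mult y L) ≡ mult y L
    count′ = begin
      δ y x′ ℕ.+ suc (mult y L)  ≡⟨ cong (δ y x′ ℕ.+_) (sym count) ⟩
      δ y x′ ℕ.+ mult y M        ≡⟨ mult-↭ y P′ ⟩
      δ y y′ ℕ.+ mult y L        ≡⟨ cong (ℕ._+ mult y L) (δ-distinct y≢y′) ⟩
      mult y L                   ∎

  singleton-↭ : ∀ {u v : A} → u ∷ [] ↭ v ∷ [] → u ≡ v
  singleton-↭ Q with ↭-singleton-inv Q
  ... | refl = refl

  pair-↭ : ∀ {x y x′ y′} → x ∷ y ∷ [] ↭ x′ ∷ y′ ∷ [] →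
           (x ≡ x′ × y ≡ y′) ⊎ (x ≡ y′ × y ≡ x′)
  pair-↭ {x′ = x′} P with ∈-resp-↭ P (here refl)
  ... | here refl         = inj₁ (refl , singleton-↭ (drop-∷ P))
  ... | there (here refl) = inj₂ (refl , singleton-↭ (drop-∷ (↭-trans P (swap x′ _ ↭-refl))))

module Congruence (d : ℕ) .{{_ : NonZero d}} where

  res : ℤ → ℕ
  res x = x %ℕ d

  infix 4 _≡ₘ_
  record _≡ₘ_ (x y : ℤ) : Set where
    constructor mod
    field
      quot : ℤ
      eqn  : x ≡ y + quot * + d

  ≡ₘ-reflexive : ∀ {x y} → x ≡ y → x ≡ₘ y
  ≡ₘ-reflexive {x} refl = mod 0ℤ (identity x (+ d))
    where identity : ∀ x D → x ≡ x + 0ℤ * D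
          identity = solve-∀

  ≡ₘ-refl : ∀ {x} → x ≡ₘ x
  ≡ₘ-refl = ≡ₘ-reflexive refl

  ≡ₘ-sym : ∀ {x y} → x ≡ₘ y → y ≡ₘ x
  ≡ₘ-sym {y = y} (mod t e) = mod (- t) (trans (identity y t (+ d)) (cong (λ z → z + - t * + d) (sym e)))
    where identity : ∀ y t D → y ≡ y + t * D + - t * D
          identity = solve-∀

  ≡ₘ-trans : ∀ {x y z} → x ≡ₘ y → y ≡ₘ z → x ≡ₘ z
  ≡ₘ-trans {z = z} (mod t refl) (mod u refl) = mod (u + t) (identity z u t (+ d))
    where identity : ∀ z u t D → z + u * D + t * D ≡ z + (u + t) * D
          identity = solve-∀

  ≡ₘ-+ : ∀ {x x′ y y′} → x ≡ₘ x′ → y ≡ₘ y′ → x + y ≡ₘ x′ + y′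
  ≡ₘ-+ {x′ = x′} {y′ = y′} (mod t refl) (mod u refl) = mod (t + u) (identity x′ y′ t u (+ d))
    where identity : ∀ x y t u D → x + t * D + (y + u * D) ≡ x + y + (t + u) * D
          identity = solve-∀

  ≡ₘ-neg : ∀ {x x′} → x ≡ₘ x′ → - x ≡ₘ - x′
  ≡ₘ-neg {x′ = x′} (mod t refl) = mod (- t) (identity x′ t (+ d))
    where identity : ∀ x t D → - (x + t * D) ≡ - x + - t * D
          identity = solve-∀

  ≡ₘ-- : ∀ {x x′ y y′} → x ≡ₘ x′ → y ≡ₘ y′ → x - y ≡ₘ x′ - y′
  ≡ₘ-- p q = ≡ₘ-+ p (≡ₘ-neg q)

  ≡ₘ-*ˡ : ∀ x {y y′} → y ≡ₘ y′ → x * y ≡ₘ x * y′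
  ≡ₘ-*ˡ x {y′ = y′} (mod t refl) = mod (x * t) (identity x y′ t (+ d))
    where identity : ∀ x y t D → x * (y + t * D) ≡ x * y + x * t * D
          identity = solve-∀

  res-≡ₘ : ∀ x → + res x ≡ₘ x
  res-≡ₘ x = ≡ₘ-sym (mod (x /ℕ d) (a≡a%ℕn+[a/ℕn]*n x d))

  private
    residue-gap : ∀ {r r′} k → r ℕ.< d → ¬ (+ r ≡ + r′ + + suc k * + d)
    residue-gap {r} {r′} k r<d e = ℕP.<⇒≱ r<d (begin
        d                   ≤⟨ ℕP.m≤n*m d (suc k) ⟩
        suc k ℕ.* d         ≤⟨ ℕP.m≤n+m _ r′ ⟩
        r′ ℕ.+ suc k ℕ.* d  ≡⟨ +-injective (sym e′) ⟩
        r                   ∎)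
      where
      open ℕP.≤-Reasoning
      e′ : + r ≡ + (r′ ℕ.+ suc k ℕ.* d)
      e′ = trans e (trans (cong (_+_ (+ r′)) (sym (pos-* (suc k) d))) (sym (pos-+ r′ _)))

  ≡ₘ-residues : ∀ {r r′} → r ℕ.< d → r′ ℕ.< d → + r ≡ₘ + r′ → r ≡ r′
  ≡ₘ-residues {r′ = r′} _ _ (mod (+ 0) e) = +-injective (trans e (identity (+ r′) (+ d)))
    where identity : ∀ x D → x + 0ℤ * D ≡ x
          identity = solve-∀
  ≡ₘ-residues r<d _ (mod +[1+ k ] e) = ⊥-elim (residue-gap k r<d e)
  ≡ₘ-residues _ r′<d p@(mod -[1+ k ] _) = ⊥-elim (residue-gap k r′<d (_≡ₘ_.eqn (≡ₘ-sym p)))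

  ≡ₘ⇒res≡ : ∀ {x y} → x ≡ₘ y → res x ≡ res y
  ≡ₘ⇒res≡ {x} {y} p = ≡ₘ-residues (n%ℕd<d x d) (n%ℕd<d y d)
    (≡ₘ-trans (res-≡ₘ x) (≡ₘ-trans p (≡ₘ-sym (res-≡ₘ y))))

  res≡⇒≡ₘ : ∀ {x y} → res x ≡ res y → x ≡ₘ y
  res≡⇒≡ₘ {x} {y} e = ≡ₘ-trans (≡ₘ-sym (res-≡ₘ x)) (≡ₘ-trans (≡ₘ-reflexive (cong +_ e)) (res-≡ₘ y))

  modulus-one : 1ℤ ≡ₘ 0ℤ → ∀ x y → x ≡ₘ y
  modulus-one h x y = ≡ₘ-trans (≡ₘ-reflexive (sym (e₁ x y)))
    (≡ₘ-trans (≡ₘ-+ (≡ₘ-refl {y}) (≡ₘ-*ˡ (x - y) h)) (≡ₘ-reflexive (e₀ x y)))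
    where e₁ : ∀ x y → y + (x - y) * 1ℤ ≡ x
          e₁ = solve-∀
          e₀ : ∀ x y → y + (x - y) * 0ℤ ≡ y
          e₀ = solve-∀

-- The weight multisets occurring in a flip, in terms of three integers
-- a, b, c with a + b + c = 1 (namely a = det p q, b = det q r, c = det r p).
module FlipWeights (d : ℕ) .{{_ : NonZero d}} where
  open Congruence d
  open Multiplicity ℕ._≟_

  ⟪_,_,_⟫ : ℤ → ℤ → ℤ → List ℕ
  ⟪ x , y , z ⟫ = res x ∷ res y ∷ res z ∷ []

  -- the weights of S₁ = pqr, S₂ = pqs, S₃ = rsp and S₄ = rsq
  W₁ W₂ W₃ W₄ : ℤ → ℤ → ℤ → List ℕ
  W₁ a b c = ⟪ a , b , c ⟫
  W₂ a b c = ⟪ a + c , a + b , - a ⟫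
  W₃ a b c = ⟪ c , a + c , b - c ⟫
  W₄ a b c = ⟪ c - b , a + b , b ⟫

  ⟪⟫-cong : ∀ {x x′ y y′ z z′} → x ≡ₘ x′ → y ≡ₘ y′ → z ≡ₘ z′ → ⟪ x , y , z ⟫ ↭ ⟪ x′ , y′ , z′ ⟫
  ⟪⟫-cong p q r = ↭-reflexive (cong₂ _∷_ (≡ₘ⇒res≡ p) (cong₂ _∷_ (≡ₘ⇒res≡ q) (cong₂ _∷_ (≡ₘ⇒res≡ r) refl)))

  ⟪⟫-reverse : ∀ x y z → ⟪ x , y , z ⟫ ↭ ⟪ z , y , x ⟫
  ⟪⟫-reverse x y z = ↭-trans (swap _ _ ↭-refl) (↭-trans (prep _ (swap _ _ ↭-refl)) (swap _ _ ↭-refl))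

  complement : ℕ → ℕ
  complement n = res (1ℤ - + n)

  complement-res : ∀ x → complement (res x) ≡ res (1ℤ - x)
  complement-res x = ≡ₘ⇒res≡ (≡ₘ-- (≡ₘ-refl {1ℤ}) (res-≡ₘ x))

  -- Since a + c = 1 - b and a + b = 1 - c, the weight of S₂ is obtained from
  -- the complemented weight {1-a, 1-b, 1-c} of S₁ by exchanging 1 - a for -a.
  W₂-exchange : ∀ a b c → a + b + c ≡ 1ℤ →
                res (- a) ∷ map complement (W₁ a b c) ↭ res (1ℤ - a) ∷ W₂ a b c
  W₂-exchange a b c sum≡1 = begin
      res (- a) ∷ map complement (W₁ a b c)
        ≡⟨ cong (res (- a) ∷_) (cong₂ _∷_ (complement-res a) (cong₂ _∷_ (complement-res b) (cong₂ _∷_ (complement-res c) refl))) ⟩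
      res (- a) ∷ res (1ℤ - a) ∷ res (1ℤ - b) ∷ res (1ℤ - c) ∷ []
        ↭⟨ ↭-sym (shift (res (- a)) (res (1ℤ - a) ∷ res (1ℤ - b) ∷ res (1ℤ - c) ∷ []) []) ⟩
      res (1ℤ - a) ∷ ⟪ 1ℤ - b , 1ℤ - c , - a ⟫
        ≡⟨ cong (res (1ℤ - a) ∷_) (cong₂ (λ u v → ⟪ u , v , - a ⟫) (sym a+c) (sym a+b)) ⟩
      res (1ℤ - a) ∷ W₂ a b c ∎
    where
    open PermutationReasoning
    a+c : a + c ≡ 1ℤ - b
    a+c = trans (identity a b c) (cong (_- b) sum≡1)
      where identity : ∀ a b c → a + c ≡ a + b + c - b
            identity = solve-∀
    a+b : a + b ≡ 1ℤ - c
    a+b = trans (identity a b c) (cong (_- c) sum≡1)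
      where identity : ∀ a b c → a + b ≡ a + b + c - c
            identity = solve-∀

  -- The weights of S₁ and S₂ determine a modulo d (when d > 1): the entry
  -- exchanged in W₂-exchange is recovered by exchange-unique.
  first-entry : ∀ a b c a′ b′ c′ → a + b + c ≡ 1ℤ → a′ + b′ + c′ ≡ 1ℤ →
                W₁ a b c ↭ W₁ a′ b′ c′ → W₂ a b c ↭ W₂ a′ b′ c′ → a ≡ₘ a′ ⊎ 1ℤ ≡ₘ 0ℤ
  first-entry a b c a′ b′ c′ sum≡1 sum′≡1 P₁ P₂ with res (- a) ℕ.≟ res (1ℤ - a)
  ... | yes same = inj₂ (≡ₘ-trans (≡ₘ-reflexive (split a))
          (≡ₘ-trans (≡ₘ-+ (res≡⇒≡ₘ {1ℤ - a} { - a} (sym same)) (≡ₘ-refl {a})) (≡ₘ-reflexive (cancel a))))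
    where split : ∀ a → 1ℤ ≡ 1ℤ - a + a
          split = solve-∀
          cancel : ∀ a → - a + a ≡ 0ℤ
          cancel = solve-∀
  ... | no differ = inj₁ (≡ₘ-trans (≡ₘ-reflexive (involution a))
          (≡ₘ-trans (≡ₘ-- (≡ₘ-refl {1ℤ}) (res≡⇒≡ₘ {1ℤ - a} {1ℤ - a′} same-exchange)) (≡ₘ-reflexive (sym (involution a′)))))
    where
    involution : ∀ a → a ≡ 1ℤ - (1ℤ - a)
    involution = solve-∀
    exchange′ : res (- a′) ∷ map complement (W₁ a b c) ↭ res (1ℤ - a′) ∷ W₂ a b c
    exchange′ = ↭-trans (prep _ (map⁺ complement P₁)) (↭-trans (W₂-exchange a′ b′ c′ sum′≡1) (prep _ (↭-sym P₂)))
    same-exchange : res (1ℤ - a) ≡ res (1ℤ - a′)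
    same-exchange = exchange-unique differ (W₂-exchange a b c sum≡1) exchange′

  other-entries : ∀ a b c a′ b′ c′ → a ≡ₘ a′ → W₁ a b c ↭ W₁ a′ b′ c′ →
                  (b ≡ₘ b′ × c ≡ₘ c′) ⊎ (b ≡ₘ c′ × c ≡ₘ b′)
  other-entries a b c a′ b′ c′ a≡a′ P₁ with pair-↭ (drop-∷ (↭-trans P₁ (↭-reflexive (cong (_∷ _) (sym (≡ₘ⇒res≡ a≡a′))))))
  ... | inj₁ (b≡b′ , c≡c′) = inj₁ (res≡⇒≡ₘ b≡b′ , res≡⇒≡ₘ c≡c′)
  ... | inj₂ (b≡c′ , c≡b′) = inj₂ (res≡⇒≡ₘ b≡c′ , res≡⇒≡ₘ c≡b′)

  aligned-weights : ∀ {a b c a′ b′ c′} → a ≡ₘ a′ → b ≡ₘ b′ → c ≡ₘ c′ →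
                    SamePair (W₃ a b c) (W₄ a b c) (W₃ a′ b′ c′) (W₄ a′ b′ c′)
  aligned-weights A B C = inj₁ (⟪⟫-cong C (≡ₘ-+ A C) (≡ₘ-- B C) , ⟪⟫-cong (≡ₘ-- C B) (≡ₘ-+ A B) B)

  swapped-weights : ∀ {a b c a′ b′ c′} → a ≡ₘ a′ → b ≡ₘ c′ → c ≡ₘ b′ →
                    SamePair (W₃ a b c) (W₄ a b c) (W₃ a′ b′ c′) (W₄ a′ b′ c′)
  swapped-weights {a′ = a′} {b′} {c′} A B C = inj₂
    ( ↭-trans (⟪⟫-cong C (≡ₘ-+ A C) (≡ₘ-- B C)) (⟪⟫-reverse b′ (a′ + b′) (c′ - b′))
    , ↭-trans (⟪⟫-cong (≡ₘ-- C B) (≡ₘ-+ A B) B) (⟪⟫-reverse (b′ - c′) (a′ + c′) c′) )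

  flip-weights : ∀ a b c a′ b′ c′ → a + b + c ≡ 1ℤ → a′ + b′ + c′ ≡ 1ℤ →
                 W₁ a b c ↭ W₁ a′ b′ c′ → W₂ a b c ↭ W₂ a′ b′ c′ →
                 SamePair (W₃ a b c) (W₄ a b c) (W₃ a′ b′ c′) (W₄ a′ b′ c′)
  flip-weights a b c a′ b′ c′ sum≡1 sum′≡1 P₁ P₂ with first-entry a b c a′ b′ c′ sum≡1 sum′≡1 P₁ P₂
  ... | inj₂ d≡1 = aligned-weights (modulus-one d≡1 a a′) (modulus-one d≡1 b b′) (modulus-one d≡1 c c′)
  ... | inj₁ a≡a′ with other-entries a b c a′ b′ c′ a≡a′ P₁
  ...   | inj₁ (b≡b′ , c≡c′) = aligned-weights a≡a′ b≡b′ c≡c′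
  ...   | inj₂ (b≡c′ , c≡b′) = swapped-weights a≡a′ b≡c′ c≡b′

Unimodular : Pt → Pt → Pt → Set
Unimodular a b c = orient a b c ≡ 1ℤ ⊎ orient a b c ≡ -1ℤ

unit-square : ∀ {D} → D ≡ 1ℤ ⊎ D ≡ -1ℤ → D * D ≡ 1ℤ
unit-square (inj₁ refl) = refl
unit-square (inj₂ refl) = refl

pos-+₃ : ∀ l m n → + (l ℕ.+ m ℕ.+ n) ≡ + l + + m + + n
pos-+₃ l m n = trans (pos-+ (l ℕ.+ m) n) (cong (_+ + n) (pos-+ l m))

hull-relative : ∀ l m n a b c p → (l ℕ.+ m ℕ.+ n) · p ≡ ((l · a) ⊕ (m · b)) ⊕ (n · c) →
                (l ℕ.+ m ℕ.+ n) · (p ⊖ a) ≡ (m · (b ⊖ a)) ⊕ (n · (c ⊖ a))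
hull-relative l m n (a₁ , a₂) (b₁ , b₂) (c₁ , c₂) (p₁ , p₂) e =
  cong₂ _,_ (coordinate a₁ b₁ c₁ p₁ (cong proj₁ e)) (coordinate a₂ b₂ c₂ p₂ (cong proj₂ e))
  where
  open ≡-Reasoning
  coordinate : ∀ a b c p → + (l ℕ.+ m ℕ.+ n) * p ≡ + l * a + + m * b + + n * c →
               + (l ℕ.+ m ℕ.+ n) * (p - a) ≡ + m * (b - a) + + n * (c - a)
  coordinate a b c p eₚ = begin
    + (l ℕ.+ m ℕ.+ n) * (p - a)                ≡⟨ cong (_* (p - a)) (pos-+₃ l m n) ⟩
    (+ l + + m + + n) * (p - a)                ≡⟨ expand (+ l + + m + + n) p a ⟩
    (+ l + + m + + n) * p - (+ l + + m + + n) * a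
      ≡⟨ cong (λ t → t - (+ l + + m + + n) * a) (trans (sym (cong (_* p) (pos-+₃ l m n))) eₚ) ⟩
    + l * a + + m * b + + n * c - (+ l + + m + + n) * a ≡⟨ collect (+ l) (+ m) (+ n) a b c ⟩
    + m * (b - a) + + n * (c - a)              ∎
    where
    expand : ∀ S p a → S * (p - a) ≡ S * p - S * a
    expand = solve-∀
    collect : ∀ l m n a b c → l * a + m * b + n * c - (l + m + n) * a ≡ m * (b - a) + n * (c - a)
    collect = solve-∀

cramer-coefficients : ∀ (N m n : ℕ) u v w → N · w ≡ (m · u) ⊕ (n · v) →
                      + N * det w v ≡ + m * det u v × + N * det u w ≡ + n * det u v
cramer-coefficients N m n (u₁ , u₂) (v₁ , v₂) (w₁ , w₂) e = first , second
  where
  open ≡-Reasoning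
  e₁ : + N * w₁ ≡ + m * u₁ + + n * v₁
  e₁ = cong proj₁ e
  e₂ : + N * w₂ ≡ + m * u₂ + + n * v₂
  e₂ = cong proj₂ e
  first : + N * (w₁ * v₂ - w₂ * v₁) ≡ + m * (u₁ * v₂ - u₂ * v₁)
  first = begin
    + N * (w₁ * v₂ - w₂ * v₁)                                ≡⟨ expand (+ N) w₁ w₂ v₁ v₂ ⟩
    (+ N * w₁) * v₂ - (+ N * w₂) * v₁                        ≡⟨ cong₂ (λ s t → s * v₂ - t * v₁) e₁ e₂ ⟩
    (+ m * u₁ + + n * v₁) * v₂ - (+ m * u₂ + + n * v₂) * v₁  ≡⟨ collect (+ m) (+ n) u₁ u₂ v₁ v₂ ⟩
    + m * (u₁ * v₂ - u₂ * v₁)                                ∎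
    where
    expand : ∀ N w₁ w₂ v₁ v₂ → N * (w₁ * v₂ - w₂ * v₁) ≡ N * w₁ * v₂ - N * w₂ * v₁
    expand = solve-∀
    collect : ∀ m n u₁ u₂ v₁ v₂ → (m * u₁ + n * v₁) * v₂ - (m * u₂ + n * v₂) * v₁ ≡ m * (u₁ * v₂ - u₂ * v₁)
    collect = solve-∀
  second : + N * (u₁ * w₂ - u₂ * w₁) ≡ + n * (u₁ * v₂ - u₂ * v₁)
  second = begin
    + N * (u₁ * w₂ - u₂ * w₁)                                ≡⟨ expand (+ N) w₁ w₂ u₁ u₂ ⟩
    u₁ * (+ N * w₂) - u₂ * (+ N * w₁)                        ≡⟨ cong₂ (λ s t → u₁ * t - u₂ * s) e₁ e₂ ⟩
    u₁ * (+ m * u₂ + + n * v₂) - u₂ * (+ m * u₁ + + n * v₁)  ≡⟨ collect (+ m) (+ n) u₁ u₂ v₁ v₂ ⟩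
    + n * (u₁ * v₂ - u₂ * v₁)                                ∎
    where
    expand : ∀ N w₁ w₂ u₁ u₂ → N * (u₁ * w₂ - u₂ * w₁) ≡ u₁ * (N * w₂) - u₂ * (N * w₁)
    expand = solve-∀
    collect : ∀ m n u₁ u₂ v₁ v₂ → u₁ * (m * u₂ + n * v₂) - u₂ * (m * u₁ + n * v₁) ≡ n * (u₁ * v₂ - u₂ * v₁)
    collect = solve-∀

cramer : ∀ u v w → det u v * proj₁ w ≡ det w v * proj₁ u + det u w * proj₁ v ×
                   det u v * proj₂ w ≡ det w v * proj₂ u + det u w * proj₂ v
cramer (u₁ , u₂) (v₁ , v₂) (w₁ , w₂) = first u₁ u₂ v₁ v₂ w₁ w₂ , second u₁ u₂ v₁ v₂ w₁ w₂
  where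
  first : ∀ u₁ u₂ v₁ v₂ w₁ w₂ → (u₁ * v₂ - u₂ * v₁) * w₁ ≡ (w₁ * v₂ - w₂ * v₁) * u₁ + (u₁ * w₂ - u₂ * w₁) * v₁
  first = solve-∀
  second : ∀ u₁ u₂ v₁ v₂ w₁ w₂ → (u₁ * v₂ - u₂ * v₁) * w₂ ≡ (w₁ * v₂ - w₂ * v₁) * u₂ + (u₁ * w₂ - u₂ * w₁) * v₂
  second = solve-∀

zero-or-whole : ∀ N m x → ¬ N ≡ 0 → m ℕ.≤ N → + m ≡ + N * x →
                (m ≡ 0 × x ≡ 0ℤ) ⊎ (m ≡ N × x ≡ 1ℤ)
zero-or-whole zero    _ _                N≢0 _   _ = ⊥-elim (N≢0 refl)
zero-or-whole (suc N) m (+ zero)         _   _   e = inj₁ (+-injective (trans e (*-zeroʳ (+ suc N))) , refl)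
zero-or-whole (suc N) m (+ suc zero)     _   _   e = inj₂ (+-injective (trans e (*-identityʳ (+ suc N))) , refl)
zero-or-whole (suc N) m (+ suc (suc k))  _   m≤N e = ⊥-elim (ℕP.<⇒≱ N<m m≤N)
  where
  N<m : suc N ℕ.< m
  N<m = subst (suc N ℕ.<_) (sym (+-injective (trans e (sym (pos-* (suc N) (suc (suc k)))))))
              (ℕP.m<m*n (suc N) (suc (suc k)) (ℕ.s≤s (ℕ.s≤s ℕ.z≤n)))
zero-or-whole (suc N) m -[1+ k ]         _   _   ()

unit-cancel : ∀ D {w z} → D * D ≡ 1ℤ → D * w ≡ z → w ≡ D * z
unit-cancel D {w} {z} DD e = begin
  w            ≡⟨ identityˡ w ⟩
  1ℤ * w       ≡⟨ cong (_* w) (sym DD) ⟩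
  D * D * w    ≡⟨ reassoc D w ⟩
  D * (D * w)  ≡⟨ cong (D *_) e ⟩
  D * z        ∎
  where
  open ≡-Reasoning
  identityˡ : ∀ w → w ≡ 1ℤ * w
  identityˡ = solve-∀
  reassoc : ∀ D w → D * D * w ≡ D * (D * w)
  reassoc = solve-∀

affine : Pt → Pt → Pt → ℤ → ℤ → Pt
affine (a₁ , a₂) (b₁ , b₂) (c₁ , c₂) x y =
  (a₁ + (x * (b₁ - a₁) + y * (c₁ - a₁)) , a₂ + (x * (b₂ - a₂) + y * (c₂ - a₂)))

affine-decomposition : ∀ a b c p x y →
  proj₁ (p ⊖ a) ≡ x * proj₁ (b ⊖ a) + y * proj₁ (c ⊖ a) →
  proj₂ (p ⊖ a) ≡ x * proj₂ (b ⊖ a) + y * proj₂ (c ⊖ a) → p ≡ affine a b c x y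
affine-decomposition (a₁ , a₂) _ _ (p₁ , p₂) _ _ e₁ e₂ =
  cong₂ _,_ (trans (recentre a₁ p₁) (cong (_+_ a₁) e₁)) (trans (recentre a₂ p₂) (cong (_+_ a₂) e₂))
  where recentre : ∀ a p → p ≡ a + (p - a)
        recentre = solve-∀

affine-a : ∀ a b c → affine a b c 0ℤ 0ℤ ≡ a
affine-a (a₁ , a₂) (b₁ , b₂) (c₁ , c₂) = cong₂ _,_ (identity a₁ b₁ c₁) (identity a₂ b₂ c₂)
  where identity : ∀ a b c → a + (0ℤ * (b - a) + 0ℤ * (c - a)) ≡ a
        identity = solve-∀

affine-b : ∀ a b c → affine a b c 1ℤ 0ℤ ≡ b
affine-b (a₁ , a₂) (b₁ , b₂) (c₁ , c₂) = cong₂ _,_ (identity a₁ b₁ c₁) (identity a₂ b₂ c₂)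
  where identity : ∀ a b c → a + (1ℤ * (b - a) + 0ℤ * (c - a)) ≡ b
        identity = solve-∀

affine-c : ∀ a b c → affine a b c 0ℤ 1ℤ ≡ c
affine-c (a₁ , a₂) (b₁ , b₂) (c₁ , c₂) = cong₂ _,_ (identity a₁ b₁ c₁) (identity a₂ b₂ c₂)
  where identity : ∀ a b c → a + (0ℤ * (b - a) + 1ℤ * (c - a)) ≡ c
        identity = solve-∀

whole-weight : ∀ l m n → m ≡ l ℕ.+ m ℕ.+ n → n ≡ 0
whole-weight l m n e = ℕP.m+n≡0⇒n≡0 l (sym (ℕP.+-cancelˡ-≡ m 0 (l ℕ.+ n)
  (trans (ℕP.+-identityʳ m) (trans e (rearrange l m n)))))
  where rearrange : ∀ l m n → l ℕ.+ m ℕ.+ n ≡ m ℕ.+ (l ℕ.+ n)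
        rearrange = ℕSolver.solve-∀

-- A unimodular triangle is d-minimal: by Cramer's rule the barycentric
-- coordinates m/N, n/N of a hull point are integers, hence 0 or 1.
unimodular⇒minimal : ∀ a b c → Unimodular a b c → Minimal a b c
unimodular⇒minimal a b c unit = nondegenerate , only-vertices
  where
  D : ℤ
  D = orient a b c
  DD : D * D ≡ 1ℤ
  DD = unit-square unit
  nondegenerate : ¬ D ≡ 0ℤ
  nondegenerate D≡0 with trans (cong (λ t → t * t) (sym D≡0)) DD
  ... | ()
  only-vertices : ∀ p → InHull a b c p → p ≡ a ⊎ (p ≡ b ⊎ p ≡ c)
  only-vertices p (l , m , n , N≢0 , eq) =
    vertex (zero-or-whole N m x N≢0 m≤N m≡Nx) (zero-or-whole N n y N≢0 n≤N n≡Ny)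
    where
    N : ℕ
    N = l ℕ.+ m ℕ.+ n
    u v w : Pt
    u = b ⊖ a
    v = c ⊖ a
    w = p ⊖ a
    x y : ℤ
    x = D * det w v
    y = D * det u w
    coefficients : + N * det w v ≡ + m * det u v × + N * det u w ≡ + n * det u v
    coefficients = cramer-coefficients N m n u v w (hull-relative l m n a b c p eq)
    m≡Nx : + m ≡ + N * x
    m≡Nx = trans (unit-cancel D DD (trans (*-comm D (+ m)) (sym (proj₁ coefficients)))) (exchange D (+ N) (det w v))
      where exchange : ∀ D N X → D * (N * X) ≡ N * (D * X)
            exchange = solve-∀
    n≡Ny : + n ≡ + N * y
    n≡Ny = trans (unit-cancel D DD (trans (*-comm D (+ n)) (sym (proj₂ coefficients)))) (exchange D (+ N) (det u w))
      where exchange : ∀ D N X → D * (N * X) ≡ N * (D * X)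
            exchange = solve-∀
    m≤N : m ℕ.≤ N
    m≤N = ℕP.≤-trans (ℕP.m≤n+m m l) (ℕP.m≤m+n (l ℕ.+ m) n)
    n≤N : n ℕ.≤ N
    n≤N = ℕP.m≤n+m n (l ℕ.+ m)
    p≡affine : p ≡ affine a b c x y
    p≡affine = affine-decomposition a b c p x y
      (trans (unit-cancel D DD (proj₁ (cramer u v w))) (distribute D (det w v) (det u w) _ _))
      (trans (unit-cancel D DD (proj₂ (cramer u v w))) (distribute D (det w v) (det u w) _ _))
      where distribute : ∀ D X Y s t → D * (X * s + Y * t) ≡ D * X * s + D * Y * t
            distribute = solve-∀
    vertex : (m ≡ 0 × x ≡ 0ℤ) ⊎ (m ≡ N × x ≡ 1ℤ) → (n ≡ 0 × y ≡ 0ℤ) ⊎ (n ≡ N × y ≡ 1ℤ) →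
             p ≡ a ⊎ (p ≡ b ⊎ p ≡ c)
    vertex (inj₁ (_ , x≡0)) (inj₁ (_ , y≡0)) = inj₁ (trans p≡affine (trans (cong₂ (affine a b c) x≡0 y≡0) (affine-a a b c)))
    vertex (inj₂ (_ , x≡1)) (inj₁ (_ , y≡0)) = inj₂ (inj₁ (trans p≡affine (trans (cong₂ (affine a b c) x≡1 y≡0) (affine-b a b c))))
    vertex (inj₁ (_ , x≡0)) (inj₂ (_ , y≡1)) = inj₂ (inj₂ (trans p≡affine (trans (cong₂ (affine a b c) x≡0 y≡1) (affine-c a b c))))
    vertex (inj₂ (m≡N , _)) (inj₂ (n≡N , _)) = ⊥-elim (N≢0 (trans (sym n≡N) (whole-weight l m n m≡N)))

ExtraPoint : Pt → Pt → Pt → Set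
ExtraPoint a b c = ∃[ p ] (InHull a b c p × ¬ p ≡ a × ¬ p ≡ b × ¬ p ≡ c)

extra-point⇒¬minimal : ∀ {a b c} → ExtraPoint a b c → ¬ Minimal a b c
extra-point⇒¬minimal (p , p∈abc , p≢a , p≢b , p≢c) (_ , only-vertices) with only-vertices p p∈abc
... | inj₁ p≡a        = p≢a p≡a
... | inj₂ (inj₁ p≡b) = p≢b p≡b
... | inj₂ (inj₂ p≡c) = p≢c p≡c

hull-swap : ∀ a b c p → InHull a c b p → InHull a b c p
hull-swap (a₁ , a₂) (b₁ , b₂) (c₁ , c₂) p (l , m , n , N≢0 , eq) =
  l , n , m , (λ e → N≢0 (trans (reorder l m n) e)) , trans (cong (_· p) (sym (reorder l m n))) (trans eq swapped)
  where
  reorder : ∀ l m n → l ℕ.+ m ℕ.+ n ≡ l ℕ.+ n ℕ.+ m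
  reorder = ℕSolver.solve-∀
  exchange : ∀ x y z → x + y + z ≡ x + z + y
  exchange = solve-∀
  swapped : ((l · (a₁ , a₂)) ⊕ (m · (c₁ , c₂))) ⊕ (n · (b₁ , b₂)) ≡ ((l · (a₁ , a₂)) ⊕ (n · (b₁ , b₂))) ⊕ (m · (c₁ , c₂))
  swapped = cong₂ _,_ (exchange (+ l * a₁) (+ m * c₁) (+ n * b₁)) (exchange (+ l * a₂) (+ m * c₂) (+ n * b₂))

extra-point-swap : ∀ a b c → ExtraPoint a c b → ExtraPoint a b c
extra-point-swap a b c (p , p∈acb , p≢a , p≢c , p≢b) = p , hull-swap a b c p p∈acb , p≢a , p≢b , p≢c

hull-from-relative : ∀ l m n a b c k → (l ℕ.+ m ℕ.+ n) · k ≡ (m · (b ⊖ a)) ⊕ (n · (c ⊖ a)) →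
                     (l ℕ.+ m ℕ.+ n) · (a ⊕ k) ≡ ((l · a) ⊕ (m · b)) ⊕ (n · c)
hull-from-relative l m n (a₁ , a₂) (b₁ , b₂) (c₁ , c₂) (k₁ , k₂) e =
  cong₂ _,_ (coordinate a₁ b₁ c₁ k₁ (cong proj₁ e)) (coordinate a₂ b₂ c₂ k₂ (cong proj₂ e))
  where
  open ≡-Reasoning
  coordinate : ∀ a b c k → + (l ℕ.+ m ℕ.+ n) * k ≡ + m * (b - a) + + n * (c - a) →
               + (l ℕ.+ m ℕ.+ n) * (a + k) ≡ + l * a + + m * b + + n * c
  coordinate a b c k eₖ = begin
    + (l ℕ.+ m ℕ.+ n) * (a + k)                             ≡⟨ expand (+ (l ℕ.+ m ℕ.+ n)) a k ⟩
    + (l ℕ.+ m ℕ.+ n) * a + + (l ℕ.+ m ℕ.+ n) * k           ≡⟨ cong₂ (λ s t → s * a + t) (pos-+₃ l m n) eₖ ⟩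
    (+ l + + m + + n) * a + (+ m * (b - a) + + n * (c - a)) ≡⟨ collect (+ l) (+ m) (+ n) a b c ⟩
    + l * a + + m * b + + n * c                             ∎
    where
    expand : ∀ N a k → N * (a + k) ≡ N * a + N * k
    expand = solve-∀
    collect : ∀ l m n a b c → (l + m + n) * a + (m * (b - a) + n * (c - a)) ≡ l * a + m * b + n * c
    collect = solve-∀

translation : ∀ a k p → a ⊕ k ≡ p → k ≡ p ⊖ a
translation (a₁ , a₂) (k₁ , k₂) _ refl = cong₂ _,_ (cancel a₁ k₁) (cancel a₂ k₂)
  where cancel : ∀ a k → k ≡ a + k - a
        cancel = solve-∀

det-zeroˡ : ∀ a v → det (a ⊖ a) v ≡ 0ℤ
det-zeroˡ (a₁ , a₂) (v₁ , v₂) = vanish a₁ a₂ v₁ v₂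
  where vanish : ∀ a₁ a₂ v₁ v₂ → (a₁ - a₁) * v₂ - (a₂ - a₂) * v₁ ≡ 0ℤ
        vanish = solve-∀

det-zeroʳ : ∀ a u → det u (a ⊖ a) ≡ 0ℤ
det-zeroʳ (a₁ , a₂) (u₁ , u₂) = vanish a₁ a₂ u₁ u₂
  where vanish : ∀ a₁ a₂ u₁ u₂ → u₁ * (a₂ - a₂) - u₂ * (a₁ - a₁) ≡ 0ℤ
        vanish = solve-∀

-- A lattice point k with D k = i (b - a) + j (c - a), where D = det(b - a, c - a),
-- 0 ≤ i, j < D, (i, j) ≠ (0, 0) and i + j ≤ D, gives the extra point a + k:
-- its barycentric weights are (D - i - j, i, j), and by Cramer's rule
-- det(k, c - a) = i and det(b - a, k) = j, so it is not a vertex.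
extra-point-from-weights : ∀ a b c (D : ℕ) → orient a b c ≡ + D → ∀ i j k →
  i ℕ.< D → j ℕ.< D → ¬ (i ≡ 0 × j ≡ 0) → i ℕ.+ j ℕ.≤ D →
  D · k ≡ (i · (b ⊖ a)) ⊕ (j · (c ⊖ a)) → ExtraPoint a b c
extra-point-from-weights a b c D orient≡D i j k i<D j<D ij≢0 i+j≤D rel =
  a ⊕ k , (l , i , j , N≢0 , hull-from-relative l i j a b c k rel′) , ≢a , ≢b , ≢c
  where
  u v : Pt
  u = b ⊖ a
  v = c ⊖ a
  l : ℕ
  l = proj₁ (ℕP.m≤n⇒∃[o]m+o≡n i+j≤D)
  sum≡D : l ℕ.+ i ℕ.+ j ≡ D
  sum≡D = trans (reorder l i j) (proj₂ (ℕP.m≤n⇒∃[o]m+o≡n i+j≤D))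
    where reorder : ∀ l i j → l ℕ.+ i ℕ.+ j ≡ i ℕ.+ j ℕ.+ l
          reorder = ℕSolver.solve-∀
  rel′ : (l ℕ.+ i ℕ.+ j) · k ≡ (i · u) ⊕ (j · v)
  rel′ = trans (cong (_· k) sum≡D) rel
  -- the total weight is D > i ≥ 0
  N≢0 : ¬ l ℕ.+ i ℕ.+ j ≡ 0
  N≢0 e = ℕP.<⇒≢ (ℕP.≤-trans (ℕ.s≤s ℕ.z≤n) i<D) (sym (trans (sym sum≡D) e))
  instance
    D-nonZero : ℤ.NonZero (+ D)
    D-nonZero = ℕ.≢-nonZero (λ D≡0 → N≢0 (trans sum≡D D≡0))
  coefficients : + D * det k v ≡ + i * det u v × + D * det u k ≡ + j * det u v
  coefficients = cramer-coefficients D i j u v k rel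
  det-kv : det k v ≡ + i
  det-kv = *-cancelˡ-≡ (+ D) _ _ (trans (proj₁ coefficients) (trans (cong (+ i *_) orient≡D) (*-comm (+ i) (+ D))))
  det-uk : det u k ≡ + j
  det-uk = *-cancelˡ-≡ (+ D) _ _ (trans (proj₂ coefficients) (trans (cong (+ j *_) orient≡D) (*-comm (+ j) (+ D))))
  ≢a : ¬ a ⊕ k ≡ a
  ≢a e = ij≢0 ( +-injective (trans (sym det-kv) (trans (cong (λ t → det t v) (translation a k a e)) (det-zeroˡ a v)))
              , +-injective (trans (sym det-uk) (trans (cong (det u) (translation a k a e)) (det-zeroʳ a u))))
  ≢b : ¬ a ⊕ k ≡ b
  ≢b e = ℕP.<⇒≢ i<D (+-injective (trans (sym det-kv) (trans (cong (λ t → det t v) (translation a k b e)) orient≡D)))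
  ≢c : ¬ a ⊕ k ≡ c
  ≢c e = ℕP.<⇒≢ j<D (+-injective (trans (sym det-uk) (trans (cong (det u) (translation a k c e)) orient≡D)))

complement-relation : ∀ D i j x y u v k → i ℕ.+ x ≡ D → j ℕ.+ y ≡ D →
  D · k ≡ (i · u) ⊕ (j · v) → D · ((u ⊕ v) ⊖ k) ≡ (x · u) ⊕ (y · v)
complement-relation D i j x y (u₁ , u₂) (v₁ , v₂) (k₁ , k₂) i+x≡D j+y≡D e =
  cong₂ _,_ (coordinate u₁ v₁ k₁ (cong proj₁ e)) (coordinate u₂ v₂ k₂ (cong proj₂ e))
  where
  open ≡-Reasoning
  D≡i+x : + D ≡ + i + + x
  D≡i+x = trans (cong +_ (sym i+x≡D)) (pos-+ i x)
  D≡j+y : + D ≡ + j + + y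
  D≡j+y = trans (cong +_ (sym j+y≡D)) (pos-+ j y)
  coordinate : ∀ u v k → + D * k ≡ + i * u + + j * v → + D * (u + v - k) ≡ + x * u + + y * v
  coordinate u v k eₖ = begin
    + D * (u + v - k)                                         ≡⟨ expand (+ D) u v k ⟩
    + D * u + + D * v - + D * k                               ≡⟨ substitute D≡i+x D≡j+y eₖ ⟩
    (+ i + + x) * u + (+ j + + y) * v - (+ i * u + + j * v)   ≡⟨ collect (+ i) (+ x) (+ j) (+ y) u v ⟩
    + x * u + + y * v                                         ∎
    where
    expand : ∀ D u v k → D * (u + v - k) ≡ D * u + D * v - D * k
    expand = solve-∀
    collect : ∀ i x j y u v → (i + x) * u + (j + y) * v - (i * u + j * v) ≡ x * u + y * v
    collect = solve-∀
    substitute : ∀ {s s′ t t′ r r′} → s ≡ s′ → t ≡ t′ → r ≡ r′ → s * u + t * v - r ≡ s′ * u + t′ * v - r′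
    substitute refl refl refl = refl

-- Any nonzero pair of residues i, j < D yields an extra point: either
-- i + j ≤ D, or the complementary pair D - i, D - j has sum below D.
extra-point-from-residues : ∀ a b c (D : ℕ) → orient a b c ≡ + D → ∀ i j k →
  i ℕ.< D → j ℕ.< D → ¬ (i ≡ 0 × j ≡ 0) →
  D · k ≡ (i · (b ⊖ a)) ⊕ (j · (c ⊖ a)) → ExtraPoint a b c
extra-point-from-residues a b c D orient≡D i j k i<D j<D ij≢0 rel with i ℕ.+ j ℕ.≤? D
... | yes i+j≤D = extra-point-from-weights a b c D orient≡D i j k i<D j<D ij≢0 i+j≤D rel
... | no  i+j≰D = extra-point-from-weights a b c D orient≡D x y ((u ⊕ v) ⊖ k) x<D y<D xy≢0 x+y≤D
                    (complement-relation D i j x y u v k i+x≡D j+y≡D rel)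
  where
  u v : Pt
  u = b ⊖ a
  v = c ⊖ a
  x : ℕ
  x = proj₁ (ℕP.m≤n⇒∃[o]m+o≡n (ℕP.<⇒≤ i<D))
  i+x≡D : i ℕ.+ x ≡ D
  i+x≡D = proj₂ (ℕP.m≤n⇒∃[o]m+o≡n (ℕP.<⇒≤ i<D))
  y : ℕ
  y = proj₁ (ℕP.m≤n⇒∃[o]m+o≡n (ℕP.<⇒≤ j<D))
  j+y≡D : j ℕ.+ y ≡ D
  j+y≡D = proj₂ (ℕP.m≤n⇒∃[o]m+o≡n (ℕP.<⇒≤ j<D))
  D<i+j : D ℕ.< i ℕ.+ j
  D<i+j = ℕP.≰⇒> i+j≰D
  x+y≤D : x ℕ.+ y ℕ.≤ D
  x+y≤D = ℕP.<⇒≤ (ℕP.+-cancelʳ-< (i ℕ.+ j) (x ℕ.+ y) D (subst (ℕ._< D ℕ.+ (i ℕ.+ j)) twice (ℕP.+-monoʳ-< D D<i+j)))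
    where twice : D ℕ.+ D ≡ x ℕ.+ y ℕ.+ (i ℕ.+ j)
          twice = trans (cong₂ ℕ._+_ (sym i+x≡D) (sym j+y≡D)) (regroup i x j y)
            where regroup : ∀ i x j y → i ℕ.+ x ℕ.+ (j ℕ.+ y) ≡ x ℕ.+ y ℕ.+ (i ℕ.+ j)
                  regroup = ℕSolver.solve-∀
  -- i = 0 would force i + j = j < D
  i≢0 : ¬ i ≡ 0
  i≢0 refl = i+j≰D (ℕP.<⇒≤ j<D)
  j≢0 : ¬ j ≡ 0
  j≢0 refl = i+j≰D (subst (ℕ._≤ D) (sym (ℕP.+-identityʳ i)) (ℕP.<⇒≤ i<D))
  x<D : x ℕ.< D
  x<D = subst (x ℕ.<_) i+x≡D (ℕP.m<n+m x (ℕP.n≢0⇒n>0 i≢0))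
  y<D : y ℕ.< D
  y<D = subst (y ℕ.<_) j+y≡D (ℕP.m<n+m y (ℕP.n≢0⇒n>0 j≢0))
  xy≢0 : ¬ (x ≡ 0 × y ≡ 0)
  xy≢0 (x≡0 , _) = ℕP.<⇒≢ i<D (trans (sym (ℕP.+-identityʳ i)) (trans (cong (i ℕ.+_) (sym x≡0)) i+x≡D))

-- Reducing the coefficients of a lattice relation i₀ u + j₀ v = D e modulo D
-- gives D k = (i₀ mod D) u + (j₀ mod D) v for the lattice point
-- k = e - (i₀ div D) u - (j₀ div D) v.
reduce-coefficients : ∀ (D : ℕ) .{{_ : NonZero D}} i₀ j₀ u v e →
  i₀ * proj₁ u + j₀ * proj₁ v ≡ + D * proj₁ e → i₀ * proj₂ u + j₀ * proj₂ v ≡ + D * proj₂ e →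
  ∃[ k ] D · k ≡ ((i₀ %ℕ D) · u) ⊕ ((j₀ %ℕ D) · v)
reduce-coefficients D i₀ j₀ (u₁ , u₂) (v₁ , v₂) (e₁ , e₂) h₁ h₂ =
  (shifted u₁ v₁ e₁ , shifted u₂ v₂ e₂) , cong₂ _,_ (coordinate u₁ v₁ e₁ h₁) (coordinate u₂ v₂ e₂ h₂)
  where
  open ≡-Reasoning
  q q′ : ℤ
  q = i₀ /ℕ D
  q′ = j₀ /ℕ D
  i j : ℤ
  i = + (i₀ %ℕ D)
  j = + (j₀ %ℕ D)
  shifted : ℤ → ℤ → ℤ → ℤ
  shifted u v e = e - q * u - q′ * v
  coordinate : ∀ u v e → i₀ * u + j₀ * v ≡ + D * e → + D * shifted u v e ≡ i * u + j * v
  coordinate u v e h = begin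
    + D * (e - q * u - q′ * v)                                 ≡⟨ expand (+ D) e q q′ u v ⟩
    + D * e - (q * + D * u + q′ * + D * v)                     ≡⟨ cong (_- (q * + D * u + q′ * + D * v)) (sym h) ⟩
    i₀ * u + j₀ * v - (q * + D * u + q′ * + D * v)
      ≡⟨ cong₂ (λ s t → s * u + t * v - (q * + D * u + q′ * + D * v)) (a≡a%ℕn+[a/ℕn]*n i₀ D) (a≡a%ℕn+[a/ℕn]*n j₀ D) ⟩
    (i + q * + D) * u + (j + q′ * + D) * v - (q * + D * u + q′ * + D * v) ≡⟨ collect i j (q * + D) (q′ * + D) u v ⟩
    i * u + j * v                                              ∎
    where
    expand : ∀ D e q q′ u v → D * (e - q * u - q′ * v) ≡ D * e - (q * D * u + q′ * D * v)
    expand = solve-∀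
    collect : ∀ i j s t u v → (i + s) * u + (j + t) * v - (s * u + t * v) ≡ i * u + j * v
    collect = solve-∀

extra-point-from-relation : ∀ a b c (D : ℕ) .{{_ : NonZero D}} → orient a b c ≡ + D → ∀ i₀ j₀ e →
  i₀ * proj₁ (b ⊖ a) + j₀ * proj₁ (c ⊖ a) ≡ + D * proj₁ e →
  i₀ * proj₂ (b ⊖ a) + j₀ * proj₂ (c ⊖ a) ≡ + D * proj₂ e →
  ¬ (i₀ %ℕ D ≡ 0 × j₀ %ℕ D ≡ 0) → ExtraPoint a b c
extra-point-from-relation a b c D orient≡D i₀ j₀ e h₁ h₂ not-divisible =
  extra-point-from-residues a b c D orient≡D (i₀ %ℕ D) (j₀ %ℕ D) k (n%ℕd<d i₀ D) (n%ℕd<d j₀ D) not-divisible rel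
  where
  reduced : ∃[ k ] D · k ≡ ((i₀ %ℕ D) · (b ⊖ a)) ⊕ ((j₀ %ℕ D) · (c ⊖ a))
  reduced = reduce-coefficients D i₀ j₀ (b ⊖ a) (c ⊖ a) e h₁ h₂
  k : Pt
  k = proj₁ reduced
  rel : D · k ≡ ((i₀ %ℕ D) · (b ⊖ a)) ⊕ ((j₀ %ℕ D) · (c ⊖ a))
  rel = proj₂ reduced

unit-multiple : ∀ D z → 1ℤ ≡ + D * z → D ≡ 1
unit-multiple D z e = ℕP.m*n≡1⇒m≡1 D ℤ.∣ z ∣ (trans (sym (abs-* (+ D) z)) (cong ℤ.∣_∣ (sym e)))

-- If det(u, v) = D ≠ 1, some row (v₂, -u₂) or (-v₁, u₁) of the adjugate
-- matrix of (u v) is nonzero modulo D; otherwise D² would divide D.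
adjugate-row : ∀ (D : ℕ) .{{_ : NonZero D}} u v → det u v ≡ + D → ¬ D ≡ 1 →
  ¬ (proj₂ v %ℕ D ≡ 0 × (- proj₂ u) %ℕ D ≡ 0) ⊎ ¬ ((- proj₁ v) %ℕ D ≡ 0 × proj₁ u %ℕ D ≡ 0)
adjugate-row D (u₁ , u₂) (v₁ , v₂) det≡D D≢1
  with v₂ %ℕ D ℕ.≟ 0 | (- u₂) %ℕ D ℕ.≟ 0 | (- v₁) %ℕ D ℕ.≟ 0 | u₁ %ℕ D ℕ.≟ 0
... | no r  | _     | _     | _     = inj₁ (λ zs → r (proj₁ zs))
... | yes _ | no r  | _     | _     = inj₁ (λ zs → r (proj₂ zs))
... | yes _ | yes _ | no r  | _     = inj₂ (λ zs → r (proj₁ zs))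
... | yes _ | yes _ | yes _ | no r  = inj₂ (λ zs → r (proj₂ zs))
... | yes r₁ | yes r₂ | yes r₃ | yes r₄ = ⊥-elim (D≢1 (unit-multiple D z (*-cancelˡ-≡ (+ D) 1ℤ (+ D * z) D≡D²z)))
  where
  open ≡-Reasoning
  multiple : ∀ x → x %ℕ D ≡ 0 → x ≡ + D * (x /ℕ D)
  multiple x r = trans (a≡a%ℕn+[a/ℕn]*n x D) (trans (cong (λ t → + t + x /ℕ D * + D) r) (identity (x /ℕ D) (+ D)))
    where identity : ∀ q D → 0ℤ + q * D ≡ D * q
          identity = solve-∀
  z : ℤ
  z = (u₁ /ℕ D) * (v₂ /ℕ D) - ((- u₂) /ℕ D) * ((- v₁) /ℕ D)
  D≡D²z : + D * 1ℤ ≡ + D * (+ D * z)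
  D≡D²z = begin
    + D * 1ℤ                   ≡⟨ *-identityʳ (+ D) ⟩
    + D                        ≡⟨ sym det≡D ⟩
    u₁ * v₂ - u₂ * v₁          ≡⟨ negate-both u₁ u₂ v₁ v₂ ⟩
    u₁ * v₂ - (- u₂) * (- v₁)  ≡⟨ cong₂ _-_ (cong₂ _*_ (multiple u₁ r₄) (multiple v₂ r₁)) (cong₂ _*_ (multiple (- u₂) r₂) (multiple (- v₁) r₃)) ⟩
    + D * (u₁ /ℕ D) * (+ D * (v₂ /ℕ D)) - + D * ((- u₂) /ℕ D) * (+ D * ((- v₁) /ℕ D))
                               ≡⟨ factor (+ D) (u₁ /ℕ D) (v₂ /ℕ D) ((- u₂) /ℕ D) ((- v₁) /ℕ D) ⟩
    + D * (+ D * z)            ∎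
    where
    negate-both : ∀ u₁ u₂ v₁ v₂ → u₁ * v₂ - u₂ * v₁ ≡ u₁ * v₂ - (- u₂) * (- v₁)
    negate-both = solve-∀
    factor : ∀ D a b c d → D * a * (D * b) - D * c * (D * d) ≡ D * (D * (a * b - c * d))
    factor = solve-∀

-- A triangle with orientation D ≥ 2 contains an extra lattice point: the
-- adjugate rows give the relations v₂ u - u₂ v = D (1, 0), -v₁ u + u₁ v = D (0, 1).
large-orientation⇒extra-point : ∀ a b c n → orient a b c ≡ + suc (suc n) → ExtraPoint a b c
large-orientation⇒extra-point a b c n orient≡D with adjugate-row (suc (suc n)) (b ⊖ a) (c ⊖ a) orient≡D (λ ())
... | inj₁ row≢0 = extra-point-from-relation a b c (suc (suc n)) orient≡D v₂ (- u₂) (1ℤ , 0ℤ)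
                     (trans (first u₁ u₂ v₁ v₂) (trans orient≡D (sym (*-identityʳ _))))
                     (trans (vanish u₂ v₂) (sym (*-zeroʳ (+ suc (suc n))))) row≢0
  where
  u₁ u₂ v₁ v₂ : ℤ
  u₁ = proj₁ (b ⊖ a)
  u₂ = proj₂ (b ⊖ a)
  v₁ = proj₁ (c ⊖ a)
  v₂ = proj₂ (c ⊖ a)
  first : ∀ u₁ u₂ v₁ v₂ → v₂ * u₁ + (- u₂) * v₁ ≡ u₁ * v₂ - u₂ * v₁
  first = solve-∀
  vanish : ∀ u₂ v₂ → v₂ * u₂ + (- u₂) * v₂ ≡ 0ℤ
  vanish = solve-∀
... | inj₂ row≢0 = extra-point-from-relation a b c (suc (suc n)) orient≡D (- v₁) u₁ (0ℤ , 1ℤ)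
                     (trans (vanish u₁ v₁) (sym (*-zeroʳ (+ suc (suc n)))))
                     (trans (second u₁ u₂ v₁ v₂) (trans orient≡D (sym (*-identityʳ _)))) row≢0
  where
  u₁ u₂ v₁ v₂ : ℤ
  u₁ = proj₁ (b ⊖ a)
  u₂ = proj₂ (b ⊖ a)
  v₁ = proj₁ (c ⊖ a)
  v₂ = proj₂ (c ⊖ a)
  vanish : ∀ u₁ v₁ → (- v₁) * u₁ + u₁ * v₁ ≡ 0ℤ
  vanish = solve-∀
  second : ∀ u₁ u₂ v₁ v₂ → (- v₁) * u₂ + u₁ * v₂ ≡ u₁ * v₂ - u₂ * v₁
  second = solve-∀

orient-swap : ∀ a b c → orient a c b ≡ - orient a b c
orient-swap (a₁ , a₂) (b₁ , b₂) (c₁ , c₂) = antisymmetry (b₁ - a₁) (b₂ - a₂) (c₁ - a₁) (c₂ - a₂)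
  where antisymmetry : ∀ u₁ u₂ v₁ v₂ → v₁ * u₂ - v₂ * u₁ ≡ - (u₁ * v₂ - u₂ * v₁)
        antisymmetry = solve-∀

minimal⇒unimodular : ∀ a b c → Minimal a b c → Unimodular a b c
minimal⇒unimodular a b c minimal = classify (orient a b c) refl
  where
  classify : ∀ D → orient a b c ≡ D → Unimodular a b c
  classify (+ zero)          e = ⊥-elim (proj₁ minimal e)
  classify (+ suc zero)      e = inj₁ e
  classify (+ suc (suc n))   e = ⊥-elim (extra-point⇒¬minimal (large-orientation⇒extra-point a b c n e) minimal)
  classify -[1+ zero ]       e = inj₂ e
  classify -[1+ suc n ]      e = ⊥-elim (extra-point⇒¬minimal
    (extra-point-swap a b c (large-orientation⇒extra-point a c b n (trans (orient-swap a b c) (cong -_ e)))) minimal)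

orient-swap₁₂ : ∀ p q r → orient q p r ≡ - orient p q r
orient-swap₁₂ (p₁ , p₂) (q₁ , q₂) (r₁ , r₂) = antisymmetry p₁ p₂ q₁ q₂ r₁ r₂
  where antisymmetry : ∀ p₁ p₂ q₁ q₂ r₁ r₂ →
          (p₁ - q₁) * (r₂ - q₂) - (p₂ - q₂) * (r₁ - q₁) ≡ - ((q₁ - p₁) * (r₂ - p₂) - (q₂ - p₂) * (r₁ - p₁))
        antisymmetry = solve-∀

orient-quadrilateral : ∀ p q r s → orient r s q ≡ orient r s p + orient p q r - orient p q s
orient-quadrilateral (p₁ , p₂) (q₁ , q₂) (r₁ , r₂) (s₁ , s₂) = identity p₁ p₂ q₁ q₂ r₁ r₂ s₁ s₂
  where identity : ∀ p₁ p₂ q₁ q₂ r₁ r₂ s₁ s₂ →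
          (s₁ - r₁) * (q₂ - r₂) - (s₂ - r₂) * (q₁ - r₁) ≡
          (s₁ - r₁) * (p₂ - r₂) - (s₂ - r₂) * (p₁ - r₁) + ((q₁ - p₁) * (r₂ - p₂) - (q₂ - p₂) * (r₁ - p₁))
            - ((q₁ - p₁) * (s₂ - p₂) - (q₂ - p₂) * (s₁ - p₁))
        identity = solve-∀

product-negative⇒-1 : ∀ X → X * (X + 1ℤ - -1ℤ) < 0ℤ → X ≡ -1ℤ
product-negative⇒-1 (+ zero)            (+<+ ())
product-negative⇒-1 (+ suc n)           (+<+ ())
product-negative⇒-1 -[1+ zero ]         _ = refl
product-negative⇒-1 -[1+ suc zero ]     (+<+ ())
product-negative⇒-1 -[1+ suc (suc n) ]  (+<+ ())

product-negative⇒1 : ∀ X → X * (X + -1ℤ - 1ℤ) < 0ℤ → X ≡ 1ℤ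
product-negative⇒1 (+ zero)             (+<+ ())
product-negative⇒1 (+ suc zero)         _ = refl
product-negative⇒1 (+ suc (suc zero))   (+<+ ())
product-negative⇒1 (+ suc (suc (suc n))) (+<+ ())
product-negative⇒1 -[1+ n ]             (+<+ ())

FlipOrientation : Pt → Pt → Pt → Pt → Set
FlipOrientation p q r s =
  orient p q r ≡ 1ℤ × orient p q s ≡ -1ℤ × orient r s p ≡ -1ℤ × orient r s q ≡ 1ℤ

-- Both triangles of a flippable pair are unimodular, so their orientations
-- are ±1 of opposite signs, and orient-quadrilateral fixes the other two.
flip-orientations : ∀ p q r s → Flippable p q r s → FlipOrientation p q r s ⊎ FlipOrientation q p r s
flip-orientations p q r s (pqr-minimal , pqs-minimal , pq-separates , rs-separates) =
  by-signs (minimal⇒unimodular p q r pqr-minimal) (minimal⇒unimodular p q s pqs-minimal)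
  where
  not-negative : ¬ 1ℤ < 0ℤ
  not-negative (+<+ ())
  by-signs : Unimodular p q r → Unimodular p q s → FlipOrientation p q r s ⊎ FlipOrientation q p r s
  by-signs (inj₁ pqr≡1) (inj₁ pqs≡1) = ⊥-elim (not-negative (subst₂ (λ x y → x * y < 0ℤ) pqr≡1 pqs≡1 pq-separates))
  by-signs (inj₂ pqr≡-1) (inj₂ pqs≡-1) = ⊥-elim (not-negative (subst₂ (λ x y → x * y < 0ℤ) pqr≡-1 pqs≡-1 pq-separates))
  by-signs (inj₁ pqr≡1) (inj₂ pqs≡-1) = inj₁ (pqr≡1 , pqs≡-1 , rsp≡-1 , trans rsq (cong (λ x → x + 1ℤ - -1ℤ) rsp≡-1))
    where
    rsq : orient r s q ≡ orient r s p + 1ℤ - -1ℤ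
    rsq = trans (orient-quadrilateral p q r s) (cong₂ (λ x y → orient r s p + x - y) pqr≡1 pqs≡-1)
    rsp≡-1 : orient r s p ≡ -1ℤ
    rsp≡-1 = product-negative⇒-1 _ (subst (λ y → orient r s p * y < 0ℤ) rsq rs-separates)
  by-signs (inj₂ pqr≡-1) (inj₁ pqs≡1) =
    inj₂ (trans (orient-swap₁₂ p q r) (cong -_ pqr≡-1) , trans (orient-swap₁₂ p q s) (cong -_ pqs≡1) ,
          trans rsq (cong (λ x → x + -1ℤ - 1ℤ) rsp≡1) , rsp≡1)
    where
    rsq : orient r s q ≡ orient r s p + -1ℤ - 1ℤ
    rsq = trans (orient-quadrilateral p q r s) (cong₂ (λ x y → orient r s p + x - y) pqr≡-1 pqs≡1)
    rsp≡1 : orient r s p ≡ 1ℤ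
    rsp≡1 = product-negative⇒1 _ (subst (λ y → orient r s p * y < 0ℤ) rsq rs-separates)

opposite-vertex : Pt → Pt → Pt → Pt
opposite-vertex p q r = (p ⊕ q) ⊖ r

-- With these orientations the quadrilateral is the parallelogram p r q s:
-- orient p q r (s - (p + q - r)) = (orient r s p + orient p q r) (p - q)
--                                 + (orient p q s + orient p q r) (r - p).
flip-parallelogram : ∀ p q r s → FlipOrientation p q r s → s ≡ opposite-vertex p q r
flip-parallelogram (p₁ , p₂) (q₁ , q₂) (r₁ , r₂) (s₁ , s₂) (pqr≡1 , pqs≡-1 , rsp≡-1 , _) =
  cong₂ _,_ (coordinate (identity₁ p₁ p₂ q₁ q₂ r₁ r₂ s₁ s₂)) (coordinate (identity₂ p₁ p₂ q₁ q₂ r₁ r₂ s₁ s₂))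
  where
  P S R : ℤ
  P = orient (p₁ , p₂) (q₁ , q₂) (r₁ , r₂)
  S = orient (p₁ , p₂) (q₁ , q₂) (s₁ , s₂)
  R = orient (r₁ , r₂) (s₁ , s₂) (p₁ , p₂)
  -- with orient r s p = orient p q s = - orient p q r = -1 the right side vanishes
  coordinate : ∀ {s o x y} → P * (s - o) ≡ (R + P) * x + (S + P) * y → s ≡ o
  coordinate {s} {o} {x} {y} e = i-j≡0⇒i≡j s o (begin
    s - o                          ≡⟨ sym (*-identityˡ (s - o)) ⟩
    1ℤ * (s - o)                   ≡⟨ cong (_* (s - o)) (sym pqr≡1) ⟩
    P * (s - o)                    ≡⟨ e ⟩
    (R + P) * x + (S + P) * y      ≡⟨ cong₂ (λ u w → u * x + w * y) (cong₂ _+_ rsp≡-1 pqr≡1) (cong₂ _+_ pqs≡-1 pqr≡1) ⟩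
    0ℤ * x + 0ℤ * y                ≡⟨ zeros x y ⟩
    0ℤ                             ∎)
    where
    open ≡-Reasoning
    zeros : ∀ x y → 0ℤ * x + 0ℤ * y ≡ 0ℤ
    zeros = solve-∀
  identity₁ : ∀ p₁ p₂ q₁ q₂ r₁ r₂ s₁ s₂ →
    ((q₁ - p₁) * (r₂ - p₂) - (q₂ - p₂) * (r₁ - p₁)) * (s₁ - (p₁ + q₁ - r₁)) ≡
    (((s₁ - r₁) * (p₂ - r₂) - (s₂ - r₂) * (p₁ - r₁)) + ((q₁ - p₁) * (r₂ - p₂) - (q₂ - p₂) * (r₁ - p₁))) * (p₁ - q₁) +
    (((q₁ - p₁) * (s₂ - p₂) - (q₂ - p₂) * (s₁ - p₁)) + ((q₁ - p₁) * (r₂ - p₂) - (q₂ - p₂) * (r₁ - p₁))) * (r₁ - p₁)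
  identity₁ = solve-∀
  identity₂ : ∀ p₁ p₂ q₁ q₂ r₁ r₂ s₁ s₂ →
    ((q₁ - p₁) * (r₂ - p₂) - (q₂ - p₂) * (r₁ - p₁)) * (s₂ - (p₂ + q₂ - r₂)) ≡
    (((s₁ - r₁) * (p₂ - r₂) - (s₂ - r₂) * (p₁ - r₁)) + ((q₁ - p₁) * (r₂ - p₂) - (q₂ - p₂) * (r₁ - p₁))) * (p₂ - q₂) +
    (((q₁ - p₁) * (s₂ - p₂) - (q₂ - p₂) * (s₁ - p₁)) + ((q₁ - p₁) * (r₂ - p₂) - (q₂ - p₂) * (r₁ - p₁))) * (r₂ - p₂)
  identity₂ = solve-∀

flip-minimal : ∀ p q r s → Flippable p q r s → Minimal r s p × Minimal r s q
flip-minimal p q r s F with flip-orientations p q r s F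
... | inj₁ (_ , _ , rsp≡-1 , rsq≡1) = unimodular⇒minimal r s p (inj₂ rsp≡-1) , unimodular⇒minimal r s q (inj₁ rsq≡1)
... | inj₂ (_ , _ , rsq≡-1 , rsp≡1) = unimodular⇒minimal r s p (inj₁ rsp≡1) , unimodular⇒minimal r s q (inj₂ rsq≡-1)

module FlipProfile (d : ℕ) .{{_ : NonZero d}} where
  open Congruence d
  open FlipWeights d

  W-ccw : ∀ x y z → orient x y z ≡ 1ℤ → W d x y z ≡ ⟪ det x y , det y z , det z x ⟫
  W-ccw x y z e rewrite e = refl

  W-cw : ∀ x y z → orient x y z ≡ -1ℤ → W d x y z ≡ ⟪ det x z , det z y , det y x ⟫
  W-cw x y z e rewrite e = refl

  W-swap : ∀ x y z → Unimodular x y z → W d x y z ↭ W d y x z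
  W-swap x y z (inj₁ e) = subst₂ _↭_ (sym (W-ccw x y z e)) (sym (W-cw y x z (trans (orient-swap₁₂ x y z) (cong -_ e))))
                            (rotate-↭ (res (det x y)) _ _)
  W-swap x y z (inj₂ e) = subst₂ _↭_ (sym (W-cw x y z e)) (sym (W-ccw y x z (trans (orient-swap₁₂ x y z) (cong -_ e))))
                            (↭-sym (rotate-↭ (res (det y x)) _ _))

  triple : ∀ {x x′ y y′ z z′} → x ≡ x′ → y ≡ y′ → z ≡ z′ → ⟪ x , y , z ⟫ ≡ ⟪ x′ , y′ , z′ ⟫
  triple refl refl refl = refl

  parallelogram-profile : ∀ p q r → FlipOrientation p q r (opposite-vertex p q r) →
    det p q + det q r + det r p ≡ 1ℤ ×
    W d p q r ≡ W₁ (det p q) (det q r) (det r p) ×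
    W d p q (opposite-vertex p q r) ≡ W₂ (det p q) (det q r) (det r p) ×
    W d r (opposite-vertex p q r) p ≡ W₃ (det p q) (det q r) (det r p) ×
    W d r (opposite-vertex p q r) q ≡ W₄ (det p q) (det q r) (det r p)
  parallelogram-profile p@(p₁ , p₂) q@(q₁ , q₂) r@(r₁ , r₂) (pqr≡1 , pqs≡-1 , rsp≡-1 , rsq≡1) =
      trans (total p₁ p₂ q₁ q₂ r₁ r₂) pqr≡1 ,
      W-ccw p q r pqr≡1 ,
      trans (W-cw p q s pqs≡-1) (triple (ps p₁ p₂ q₁ q₂ r₁ r₂) (sq p₁ p₂ q₁ q₂ r₁ r₂) (qp p₁ p₂ q₁ q₂)) ,
      trans (W-cw r s p rsp≡-1) (triple (refl {x = det r p}) (ps p₁ p₂ q₁ q₂ r₁ r₂) (sr p₁ p₂ q₁ q₂ r₁ r₂)) ,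
      trans (W-ccw r s q rsq≡1) (triple (rs p₁ p₂ q₁ q₂ r₁ r₂) (sq p₁ p₂ q₁ q₂ r₁ r₂) (refl {x = det q r}))
    where
    s : Pt
    s = opposite-vertex p q r
    total : ∀ p₁ p₂ q₁ q₂ r₁ r₂ → (p₁ * q₂ - p₂ * q₁) + (q₁ * r₂ - q₂ * r₁) + (r₁ * p₂ - r₂ * p₁) ≡ (q₁ - p₁) * (r₂ - p₂) - (q₂ - p₂) * (r₁ - p₁)
    total = solve-∀
    ps : ∀ p₁ p₂ q₁ q₂ r₁ r₂ → p₁ * (p₂ + q₂ - r₂) - p₂ * (p₁ + q₁ - r₁) ≡ (p₁ * q₂ - p₂ * q₁) + (r₁ * p₂ - r₂ * p₁)
    ps = solve-∀
    sq : ∀ p₁ p₂ q₁ q₂ r₁ r₂ → (p₁ + q₁ - r₁) * q₂ - (p₂ + q₂ - r₂) * q₁ ≡ (p₁ * q₂ - p₂ * q₁) + (q₁ * r₂ - q₂ * r₁)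
    sq = solve-∀
    qp : ∀ p₁ p₂ q₁ q₂ → q₁ * p₂ - q₂ * p₁ ≡ - (p₁ * q₂ - p₂ * q₁)
    qp = solve-∀
    sr : ∀ p₁ p₂ q₁ q₂ r₁ r₂ → (p₁ + q₁ - r₁) * r₂ - (p₂ + q₂ - r₂) * r₁ ≡ (q₁ * r₂ - q₂ * r₁) - (r₁ * p₂ - r₂ * p₁)
    sr = solve-∀
    rs : ∀ p₁ p₂ q₁ q₂ r₁ r₂ → r₁ * (p₂ + q₂ - r₂) - r₂ * (p₁ + q₁ - r₁) ≡ (r₁ * p₂ - r₂ * p₁) - (q₁ * r₂ - q₂ * r₁)
    rs = solve-∀

  CCWProfile : Pt → Pt → Pt → Pt → Set
  CCWProfile p q r s = ∃[ a ] ∃[ b ] ∃[ c ] (a + b + c ≡ 1ℤ ×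
    W d p q r ↭ W₁ a b c × W d p q s ↭ W₂ a b c × W d r s p ↭ W₃ a b c × W d r s q ↭ W₄ a b c)

  ccw-profile : ∀ p q r s → FlipOrientation p q r s → CCWProfile p q r s
  ccw-profile p q r s o = subst (CCWProfile p q r) (sym s≡) (on-parallelogram (parallelogram-profile p q r (subst (FlipOrientation p q r) s≡ o)))
    where
    s≡ : s ≡ opposite-vertex p q r
    s≡ = flip-parallelogram p q r s o
    on-parallelogram : let a = det p q ; b = det q r ; c = det r p ; s′ = opposite-vertex p q r in
      a + b + c ≡ 1ℤ × W d p q r ≡ W₁ a b c × W d p q s′ ≡ W₂ a b c × W d r s′ p ≡ W₃ a b c × W d r s′ q ≡ W₄ a b c →
      CCWProfile p q r s′
    on-parallelogram (total , e₁ , e₂ , e₃ , e₄) =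
      det p q , det q r , det r p , total , ↭-reflexive e₁ , ↭-reflexive e₂ , ↭-reflexive e₃ , ↭-reflexive e₄

  Profile : Pt → Pt → Pt → Pt → Set
  Profile p q r s = ∃[ a ] ∃[ b ] ∃[ c ] (a + b + c ≡ 1ℤ ×
    W d p q r ↭ W₁ a b c × W d p q s ↭ W₂ a b c × SamePair (W d r s p) (W d r s q) (W₃ a b c) (W₄ a b c))

  -- Every flippable pair has a profile: in the clockwise case use the
  -- counterclockwise configuration q p r s, which has the same weights.
  flippable-profile : ∀ p q r s → Flippable p q r s → Profile p q r s
  flippable-profile p q r s F@(pqr-minimal , pqs-minimal , _) =
    [ (λ o → counterclockwise (ccw-profile p q r s o)) , (λ o → clockwise (ccw-profile q p r s o)) ]′
      (flip-orientations p q r s F)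
    where
    counterclockwise : CCWProfile p q r s → Profile p q r s
    counterclockwise (a , b , c , total , P₁ , P₂ , P₃ , P₄) = a , b , c , total , P₁ , P₂ , inj₁ (P₃ , P₄)
    clockwise : CCWProfile q p r s → Profile p q r s
    clockwise (a , b , c , total , P₁ , P₂ , P₃ , P₄) =
      a , b , c , total ,
      ↭-trans (W-swap p q r (minimal⇒unimodular p q r pqr-minimal)) P₁ ,
      ↭-trans (W-swap p q s (minimal⇒unimodular p q s pqs-minimal)) P₂ ,
      inj₂ (P₄ , P₃)

  flip-well-defined : ∀ p q r s p′ q′ r′ s′ → Profile p q r s → Profile p′ q′ r′ s′ →
    W d p q r ↭ W d p′ q′ r′ → W d p q s ↭ W d p′ q′ s′ →
    SamePair (W d r s p) (W d r s q) (W d r′ s′ p′) (W d r′ s′ q′)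
  flip-well-defined p q r s p′ q′ r′ s′ (a , b , c , total , Q₁ , Q₂ , flipped) (a′ , b′ , c′ , total′ , Q₁′ , Q₂′ , flipped′) P₁ P₂ =
    SamePair-trans flipped (SamePair-trans
      (flip-weights a b c a′ b′ c′ total total′ (↭-trans (↭-sym Q₁) (↭-trans P₁ Q₁′)) (↭-trans (↭-sym Q₂) (↭-trans P₂ Q₂′)))
      (SamePair-sym flipped′))

proposition4p3 : (d : ℕ) → .{{_ : NonZero d}} → (p q r s p′ q′ r′ s′ : Pt) →
    Flippable p q r s → Flippable p′ q′ r′ s′ →
    W d p q r ↭ W d p′ q′ r′ → W d p q s ↭ W d p′ q′ s′ →
    (Minimal r s p × Minimal r s q × Minimal r′ s′ p′ × Minimal r′ s′ q′) ×
    ((W d r s p ↭ W d r′ s′ p′ × W d r s q ↭ W d r′ s′ q′) ⊎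
    (W d r s p ↭ W d r′ s′ q′ × W d r s q ↭ W d r′ s′ p′))
proposition4p3 d p q r s p′ q′ r′ s′ F F′ P₁ P₂ =
  (proj₁ new , proj₂ new , proj₁ new′ , proj₂ new′) ,
  flip-well-defined p q r s p′ q′ r′ s′ (flippable-profile p q r s F) (flippable-profile p′ q′ r′ s′ F′) P₁ P₂
  where
  open FlipProfile d
  new : Minimal r s p × Minimal r s q
  new = flip-minimal p q r s F
  new′ : Minimal r′ s′ p′ × Minimal r′ s′ q′
  new′ = flip-minimal p′ q′ r′ s′ F′
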